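{- Let $\mathcal{S}_1=(E,\mathcal{I}_1)$ and $\mathcal{S}_2=(E,\mathcal{I}_2)$ be $r$-covering systems with activities $\texttt{a}_1$ and $\texttt{a}_2$ respectively. If $\mathcal{I}_1\cap\mathcal{I}_2=\emptyset$, then $\mathcal{S}=(E,\mathcal{I}_1\cup\mathcal{I}_2)$ is a covering system with an activity $\texttt{a}$ given, for each basis $B$ of $\mathcal{S}$, by $\texttt{a}(B)=\texttt{a}_1(B)$ if $B\in\mathcal{I}_1$ and $\texttt{a}(B)=\texttt{a}_2(B)$ if $B\in\mathcal{I}_2$.
   Context: For finite sets $X\subseteq Y$, write $[X,Y]=\{Z : X\subseteq Z\subseteq Y\}$. An $r$-covering system is a pair $\mathcal{S}=(E,\mathcal{I})$ with $E$ a finite set and $\mathcal{I}$ a collection of subsets of $E$, each of cardinality at most $r$, such that for every $I\in\mathcal{I}$ there is an $r$-element set $B\in\mathcal{I}$ with $[I,B]\subseteq\mathcal{I}$; a covering system is an $r$-covering system for some $r$. The $r$-element sets in $\mathcal{I}$ are called bases. An activity of a covering system with set of bases $\mathcal{B}$ and independent sets $\mathcal{I}$ is a function $\texttt{a}:\mathcal{B}\to 2^E$ with $\texttt{a}(B)\subseteq B$, $[B\setminus\texttt{a}(B),B]\subseteq\mathcal{I}$ for all $B\in\mathcal{B}$, and such that every $I\in\mathcal{I}$ lies in $[B\setminus\texttt{a}(B),B]$ for exactly one $B\in\mathcal{B}$. -}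

module Defs where

open import Data.Nat using (ℕ; _≤_)
open import Data.Bool using (Bool; true; false; _∨_; if_then_else_; T)
open import Data.Fin.Subset using (Subset; _⊆_; _─_; ∣_∣)
open import Data.Product using (Σ; _×_; _,_; ∃)
open import Data.Empty using (⊥)
open import Relation.Binary.PropositionalEquality using (_≡_)

-- The ground set E is Fin n; subsets of E are 'Subset n'.
-- A collection 𝓘 of subsets of E is a (decidable) predicate Subset n → Bool
-- (E is finite, so every collection of subsets is of this form).
Collection : ℕ → Set
Collection n = Subset n → Bool

module _ {n : ℕ} where

  _∈𝓘_ : Subset n → Collection n → Set
  Z ∈𝓘 𝓘 = T (𝓘 Z)

  IntervalIn : Subset n → Subset n → Collection n → Set
  IntervalIn X Y 𝓘 = ∀ Z → X ⊆ Z → Z ⊆ Y → Z ∈𝓘 𝓘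

  InInterval : Subset n → Subset n → Subset n → Set
  InInterval Z X Y = X ⊆ Z × Z ⊆ Y

  IsBasis : ℕ → Collection n → Subset n → Set
  IsBasis r 𝓘 B = B ∈𝓘 𝓘 × ∣ B ∣ ≡ r

  IsRCoveringSystem : ℕ → Collection n → Set
  IsRCoveringSystem r 𝓘 =
    (∀ I → I ∈𝓘 𝓘 → ∣ I ∣ ≤ r) ×
    (∀ I → I ∈𝓘 𝓘 → Σ (Subset n) λ B → IsBasis r 𝓘 B × I ⊆ B × IntervalIn I B 𝓘)

  IsCoveringSystem : Collection n → Set
  IsCoveringSystem 𝓘 = ∃ λ r → IsRCoveringSystem r 𝓘

  -- a : 𝓑 → 2^E is an activity of the r-covering system (E , 𝓘).
  -- a is given as a total function on subsets; only its values on bases matter.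
  IsActivity : ℕ → Collection n → (Subset n → Subset n) → Set
  IsActivity r 𝓘 a =
    (∀ B → IsBasis r 𝓘 B → a B ⊆ B × IntervalIn (B ─ a B) B 𝓘) ×
    (∀ I → I ∈𝓘 𝓘 →
       Σ (Subset n) λ B → (IsBasis r 𝓘 B × InInterval I (B ─ a B) B) ×
         (∀ B′ → IsBasis r 𝓘 B′ → InInterval I (B′ ─ a B′) B′ → B′ ≡ B))

  _∪𝓘_ : Collection n → Collection n → Collection n
  (𝓘₁ ∪𝓘 𝓘₂) Z = 𝓘₁ Z ∨ 𝓘₂ Z

  Disjoint : Collection n → Collection n → Set
  Disjoint 𝓘₁ 𝓘₂ = ∀ Z → Z ∈𝓘 𝓘₁ → Z ∈𝓘 𝓘₂ → ⊥

  -- the combined activity: a(B) = a₁(B) if B ∈ 𝓘₁, and a₂(B) otherwise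
  -- (on bases of the union, "otherwise" means B ∈ 𝓘₂)
  combine : Collection n → (Subset n → Subset n) → (Subset n → Subset n) → Subset n → Subset n
  combine 𝓘₁ a₁ a₂ B = if 𝓘₁ B then a₁ B else a₂ B

-- An independent set of the union lies in exactly one of 𝓘₁, 𝓘₂, and its basis must be taken
-- from the same side: an activity interval [B ─ a₂ B , B] of a basis of 𝓘₂ lies inside 𝓘₂, so
-- disjointness keeps every set of 𝓘₁ out of it. The combined activity restricts to a₁ and a₂ on
-- the bases of the two sides, so both activity axioms transfer from the summands.
module Submission where

open import Defs
open import Data.Nat using (ℕ; _≤_)
open import Data.Fin.Subset using (Subset; _⊆_; _─_; ∣_∣)
open import Data.Bool using (true; false)
open import Data.Bool.Properties using (T-≡; T-∨)
open import Data.Product using (Σ; _×_; _,_; proj₁; proj₂; map₁; map₂)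
open import Data.Sum using (_⊎_; inj₁; inj₂; [_,_]′)
open import Data.Empty using (⊥-elim)
open import Function using (_∘_; _∘′_)
open import Function.Bundles using (Equivalence)
open import Relation.Nullary using (¬_)
open import Relation.Binary.PropositionalEquality using (_≡_; refl; sym; subst)

module _ {n : ℕ} where

  infix 4 _⊆𝓘_

  _⊆𝓘_ : Collection n → Collection n → Set
  𝓘 ⊆𝓘 𝓙 = ∀ Z → Z ∈𝓘 𝓘 → Z ∈𝓘 𝓙

  BasisAbove : ℕ → Collection n → Subset n → Set
  BasisAbove r 𝓘 I = Σ (Subset n) λ B → IsBasis r 𝓘 B × I ⊆ B × IntervalIn I B 𝓘

  ActivityBasis : ℕ → Collection n → (Subset n → Subset n) → Subset n → Subset n → Set
  ActivityBasis r 𝓘 a I B = IsBasis r 𝓘 B × InInterval I (B ─ a B) B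

  UniqueActivityBasis : ℕ → Collection n → (Subset n → Subset n) → Subset n → Set
  UniqueActivityBasis r 𝓘 a I =
    Σ (Subset n) λ B → ActivityBasis r 𝓘 a I B ×
      (∀ B′ → IsBasis r 𝓘 B′ → InInterval I (B′ ─ a B′) B′ → B′ ≡ B)

  module _ {𝓘 𝓙 : Collection n} (𝓘⊆𝓙 : 𝓘 ⊆𝓘 𝓙) where

    IntervalIn-mono : ∀ {X Y} → IntervalIn X Y 𝓘 → IntervalIn X Y 𝓙
    IntervalIn-mono X⋯Y⊆𝓘 Z X⊆Z Z⊆Y = 𝓘⊆𝓙 Z (X⋯Y⊆𝓘 Z X⊆Z Z⊆Y)

    IsBasis-mono : ∀ {r B} → IsBasis r 𝓘 B → IsBasis r 𝓙 B
    IsBasis-mono = map₁ (𝓘⊆𝓙 _)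

    BasisAbove-mono : ∀ {r I} → BasisAbove r 𝓘 I → BasisAbove r 𝓙 I
    BasisAbove-mono (B , isBasis , I⊆B , I⋯B⊆𝓘) =
      B , IsBasis-mono isBasis , I⊆B , IntervalIn-mono I⋯B⊆𝓘

  activity-interval-∈ : ∀ {r} {𝓘 : Collection n} {a I} → IsActivity r 𝓘 a →
                        ∀ B → IsBasis r 𝓘 B → InInterval I (B ─ a B) B → I ∈𝓘 𝓘
  activity-interval-∈ (bounds , _) B isBasis (lo , hi) = proj₂ (bounds B isBasis) _ lo hi

  InInterval-─-cong : ∀ {I} B {A A′ : Subset n} → A ≡ A′ →
                      InInterval I (B ─ A) B → InInterval I (B ─ A′) B
  InInterval-─-cong {I} B = subst (λ A → InInterval I (B ─ A) B)

  module _ {r : ℕ} {𝓙 𝓘 : Collection n} {aⱼ a : Subset n → Subset n}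
           (𝓙⊆𝓘 : 𝓙 ⊆𝓘 𝓘) (actⱼ : IsActivity r 𝓙 aⱼ)
           (agree : ∀ B → IsBasis r 𝓙 B → a B ≡ aⱼ B) where

    activity-bounds-mono : ∀ B → IsBasis r 𝓙 B → a B ⊆ B × IntervalIn (B ─ a B) B 𝓘
    activity-bounds-mono B isBasis rewrite agree B isBasis =
      map₂ (IntervalIn-mono 𝓙⊆𝓘) (proj₁ actⱼ B isBasis)

    uniqueActivityBasis-mono :
      (∀ {I} → I ∈𝓘 𝓙 → ∀ B → IsBasis r 𝓘 B → InInterval I (B ─ a B) B → IsBasis r 𝓙 B) →
      ∀ I → I ∈𝓘 𝓙 → UniqueActivityBasis r 𝓘 a I
    uniqueActivityBasis-mono confine I I∈𝓙 with proj₂ actⱼ I I∈𝓙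
    ... | B , (isBasis , I∈B⋯) , unique =
      B , (IsBasis-mono 𝓙⊆𝓘 isBasis , InInterval-─-cong B (sym (agree B isBasis)) I∈B⋯) , unique′
      where
      unique′ : ∀ B′ → IsBasis r 𝓘 B′ → InInterval I (B′ ─ a B′) B′ → B′ ≡ B
      unique′ B′ isBasis′ I∈B′⋯ =
        unique B′ isBasisⱼ (InInterval-─-cong B′ (agree B′ isBasisⱼ) I∈B′⋯)
        where isBasisⱼ = confine I∈𝓙 B′ isBasis′ I∈B′⋯

  module _ {𝓘₁ 𝓘₂ : Collection n} where

    ∪𝓘⁺ˡ : 𝓘₁ ⊆𝓘 𝓘₁ ∪𝓘 𝓘₂
    ∪𝓘⁺ˡ Z = Equivalence.from T-∨ ∘′ inj₁

    ∪𝓘⁺ʳ : 𝓘₂ ⊆𝓘 𝓘₁ ∪𝓘 𝓘₂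
    ∪𝓘⁺ʳ Z = Equivalence.from (T-∨ {𝓘₁ Z}) ∘′ inj₂

    ∪𝓘⁻ : ∀ {Z} → Z ∈𝓘 (𝓘₁ ∪𝓘 𝓘₂) → Z ∈𝓘 𝓘₁ ⊎ Z ∈𝓘 𝓘₂
    ∪𝓘⁻ {Z} = Equivalence.to (T-∨ {𝓘₁ Z})

    IsBasis-∪⁻ : ∀ {r B} → IsBasis r (𝓘₁ ∪𝓘 𝓘₂) B → IsBasis r 𝓘₁ B ⊎ IsBasis r 𝓘₂ B
    IsBasis-∪⁻ (B∈𝓘 , ∣B∣≡r) = [ inj₁ ∘ (_, ∣B∣≡r) , inj₂ ∘ (_, ∣B∣≡r) ]′ (∪𝓘⁻ B∈𝓘)

    ∪-isRCoveringSystem : ∀ {r} → IsRCoveringSystem r 𝓘₁ → IsRCoveringSystem r 𝓘₂ →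
                          IsRCoveringSystem r (𝓘₁ ∪𝓘 𝓘₂)
    ∪-isRCoveringSystem {r} (bound₁ , extend₁) (bound₂ , extend₂) = bound , extend
      where
      bound : ∀ I → I ∈𝓘 (𝓘₁ ∪𝓘 𝓘₂) → ∣ I ∣ ≤ r
      bound I I∈𝓘 = [ bound₁ I , bound₂ I ]′ (∪𝓘⁻ I∈𝓘)

      extend : ∀ I → I ∈𝓘 (𝓘₁ ∪𝓘 𝓘₂) → BasisAbove r (𝓘₁ ∪𝓘 𝓘₂) I
      extend I I∈𝓘 =
        [ BasisAbove-mono ∪𝓘⁺ˡ ∘′ extend₁ I , BasisAbove-mono ∪𝓘⁺ʳ ∘′ extend₂ I ]′ (∪𝓘⁻ I∈𝓘)

    module _ {a₁ a₂ : Subset n → Subset n} where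

      combine-∈ : ∀ {B} → B ∈𝓘 𝓘₁ → combine 𝓘₁ a₁ a₂ B ≡ a₁ B
      combine-∈ B∈𝓘₁ rewrite Equivalence.to T-≡ B∈𝓘₁ = refl

      combine-∉ : ∀ {B} → ¬ B ∈𝓘 𝓘₁ → combine 𝓘₁ a₁ a₂ B ≡ a₂ B
      combine-∉ {B} B∉𝓘₁ with 𝓘₁ B
      ... | true  = ⊥-elim (B∉𝓘₁ _)
      ... | false = refl

      ∪-isActivity : ∀ {r} → Disjoint 𝓘₁ 𝓘₂ → IsActivity r 𝓘₁ a₁ → IsActivity r 𝓘₂ a₂ →
                     IsActivity r (𝓘₁ ∪𝓘 𝓘₂) (combine 𝓘₁ a₁ a₂)
      ∪-isActivity {r} disjoint act₁ act₂ = bounds , unique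
        where
        a = combine 𝓘₁ a₁ a₂

        agree₁ : ∀ B → IsBasis r 𝓘₁ B → a B ≡ a₁ B
        agree₁ B = combine-∈ ∘ proj₁

        agree₂ : ∀ B → IsBasis r 𝓘₂ B → a B ≡ a₂ B
        agree₂ B (B∈𝓘₂ , _) = combine-∉ λ B∈𝓘₁ → disjoint B B∈𝓘₁ B∈𝓘₂

        bounds : ∀ B → IsBasis r (𝓘₁ ∪𝓘 𝓘₂) B → a B ⊆ B × IntervalIn (B ─ a B) B (𝓘₁ ∪𝓘 𝓘₂)
        bounds B isBasis =
          [ activity-bounds-mono ∪𝓘⁺ˡ act₁ agree₁ B , activity-bounds-mono ∪𝓘⁺ʳ act₂ agree₂ B ]′
            (IsBasis-∪⁻ isBasis)

        confine₁ : ∀ {I} → I ∈𝓘 𝓘₁ → ∀ B → IsBasis r (𝓘₁ ∪𝓘 𝓘₂) B →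
                   InInterval I (B ─ a B) B → IsBasis r 𝓘₁ B
        confine₁ {I} I∈𝓘₁ B isBasis I∈B⋯ with IsBasis-∪⁻ isBasis
        ... | inj₁ isBasis₁ = isBasis₁
        ... | inj₂ isBasis₂ = ⊥-elim (disjoint I I∈𝓘₁
          (activity-interval-∈ act₂ B isBasis₂ (InInterval-─-cong B (agree₂ B isBasis₂) I∈B⋯)))

        confine₂ : ∀ {I} → I ∈𝓘 𝓘₂ → ∀ B → IsBasis r (𝓘₁ ∪𝓘 𝓘₂) B →
                   InInterval I (B ─ a B) B → IsBasis r 𝓘₂ B
        confine₂ {I} I∈𝓘₂ B isBasis I∈B⋯ with IsBasis-∪⁻ isBasis
        ... | inj₂ isBasis₂ = isBasis₂
        ... | inj₁ isBasis₁ = ⊥-elim (disjoint I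
          (activity-interval-∈ act₁ B isBasis₁ (InInterval-─-cong B (agree₁ B isBasis₁) I∈B⋯))
          I∈𝓘₂)

        unique : ∀ I → I ∈𝓘 (𝓘₁ ∪𝓘 𝓘₂) → UniqueActivityBasis r (𝓘₁ ∪𝓘 𝓘₂) a I
        unique I I∈𝓘 =
          [ uniqueActivityBasis-mono ∪𝓘⁺ˡ act₁ agree₁ confine₁ I
          , uniqueActivityBasis-mono ∪𝓘⁺ʳ act₂ agree₂ confine₂ I ]′ (∪𝓘⁻ I∈𝓘)

proposition3p7 : (n r : ℕ) (𝓘₁ 𝓘₂ : Collection n) (a₁ a₂ : Subset n → Subset n) →
    IsRCoveringSystem r 𝓘₁ → IsRCoveringSystem r 𝓘₂ →
    IsActivity r 𝓘₁ a₁ → IsActivity r 𝓘₂ a₂ →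
    Disjoint 𝓘₁ 𝓘₂ →
    IsRCoveringSystem r (𝓘₁ ∪𝓘 𝓘₂) × IsActivity r (𝓘₁ ∪𝓘 𝓘₂) (combine 𝓘₁ a₁ a₂)
proposition3p7 n r 𝓘₁ 𝓘₂ a₁ a₂ cover₁ cover₂ act₁ act₂ disjoint =
  ∪-isRCoveringSystem cover₁ cover₂ , ∪-isActivity disjoint act₁ act₂
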